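{- Let $t,n$ be positive integers with $t\le 2n-2$. Then $dyn_t(K_n\Box K_n)=\left\lceil \dfrac t2\right\rceil^2$ if $t$ is odd, and $dyn_t(K_n\Box K_n)=\dfrac t2\left(\dfrac t2+1\right)$ if $t$ is even.
   Context: $K_n$ is the complete graph on $n$ vertices; $G\Box H$ is the Cartesian product (vertex set $V(G)\times V(H)$, $(u,v)\sim(u',v')$ iff $u=u'$ and $vv'\in E(H)$, or $v=v'$ and $uu'\in E(G)$). For constant threshold $t$, a set $D$ of vertices is a $t$-dynamic monopoly if starting from $D$ and repeatedly adding any vertex having at least $t$ neighbors in the current set eventually yields all vertices; $dyn_t$ is the minimum size of a $t$-dynamic monopoly. -}

module Defs where

open import Data.Nat using (ℕ; _≤_)
open import Data.Fin using (Fin)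
open import Data.Product using (_×_; _,_; Σ)
open import Data.Sum using (_⊎_)
open import Data.List using (List; length)
open import Data.List.Membership.Propositional using (_∈_)
open import Data.List.Relation.Unary.All using (All)
open import Data.List.Relation.Unary.Unique.Propositional using (Unique)
open import Relation.Binary.PropositionalEquality using (_≡_; _≢_)

record Graph : Set₁ where
  field
    V   : Set
    Adj : V → V → Set
open Graph public

K : ℕ → Graph
K n = record { V = Fin n ; Adj = λ i j → i ≢ j }

_□_ : Graph → Graph → Graph
G □ H = record
  { V   = V G × V H
  ; Adj = λ { (u , v) (u' , v') →
              (u ≡ u' × Adj H v v') ⊎ (v ≡ v' × Adj G u u') } }

data Active (G : Graph) (t : ℕ) (D : List (V G)) : V G → Set where
  seed : ∀ {v} → v ∈ D → Active G t D v
  step : ∀ {v} (ns : List (V G)) → Unique ns → t ≤ length ns →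
         All (λ w → Adj G v w × Active G t D w) ns → Active G t D v

IsDynMono : (G : Graph) → ℕ → List (V G) → Set
IsDynMono G t D = ∀ v → Active G t D v

-- dyn_t(G) = k : some t-dynamic monopoly (a duplicate-free list, i.e. a set)
-- has exactly k vertices, and every t-dynamic monopoly has at least k.
DynIs : (G : Graph) → ℕ → ℕ → Set
DynIs G t k =
  Σ (List (V G)) (λ D → Unique D × IsDynMono G t D × length D ≡ k)
  × (∀ (D : List (V G)) → Unique D → IsDynMono G t D → k ≤ length D)

-- If D is a t-dynamic monopoly of K_n □ K_n with t < 2n and D is not everything, the first vertex
-- activated outside D has t neighbours in D, so some cross (a row together with a column) holds at
-- least t seeds. Deleting that cross costs every remaining vertex at most two neighbours, so the rest
-- of D is a (t-2)-dynamic monopoly of K_{n-1} □ K_{n-1}; hence |D| ≥ t + (t-2) + (t-4) + ⋯, which is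
-- ⌈t/2⌉² or (t/2)(t/2+1).
-- Conversely, for X + Y = t with X = ⌈t/2⌉, Y = ⌊t/2⌋, the seeds i + j < X and i + j > 2(n-1) - Y, two
-- corner triangles of sizes X(X+1)/2 and Y(Y+1)/2, activate everything: row 0 fills in from its far
-- end, column 0 by symmetry, and then every inner cell already has two active neighbours on row 0 and
-- column 0, while the inner grid, turned by a half turn, carries the same pattern for (Y, X - 2).
module Submission where

open import Defs
open import Data.Nat using (ℕ; zero; suc; _≤_; _<_; _≮_; _∸_; _+_; _*_; z≤n; s≤s)
open import Data.Nat.Properties
open import Data.Nat.Solver using (module +-*-Solver)
open +-*-Solver using (solve; _:+_; _:*_; _:=_; con)
open import Data.Fin using (Fin; zero; suc; toℕ; punchIn; punchOut; opposite) renaming (_>_ to _>ᶠ_)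
open import Data.Fin.Induction using (>-wellFounded)
open import Induction.WellFounded using (Acc; acc)
open import Data.Fin.Properties using (punchIn-injective; punchInᵢ≢i; punchIn-punchOut; toℕ<n;
  opposite-prop; opposite-involutive; toℕ-injective) renaming (_≟_ to _≟ᶠ_; suc-injective to suc-injectiveᶠ)
open import Data.Product using (_×_; _,_; Σ; ∃; proj₁; proj₂)
open import Data.Product.Properties using (≡-dec)
open import Data.Sum using (_⊎_; inj₁; inj₂)
import Data.Sum as Sum
open import Data.List using (List; []; _∷_; length; _++_; map; filter; cartesianProduct; allFin; tabulate; upTo)
open import Data.List.Properties using (length-++; length-map; length-tabulate; filter-all; length-upTo)
open import Data.List.Membership.Propositional using (_∈_; _∉_)
open import Data.List.Membership.Propositional.Properties
open import Data.List.Relation.Binary.Subset.Propositional using (_⊆_)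
open import Data.List.Relation.Unary.All as All using (All; []; _∷_; all?)
open import Data.List.Relation.Unary.All.Properties
  using (¬All⇒Any¬; tabulate⁺; map⁺; all-filter) renaming (++⁺ to All-++⁺)
open import Data.List.Relation.Unary.Any using (here; there; any?; satisfied)
open import Data.List.Relation.Unary.AllPairs using ([]; _∷_)
open import Data.List.Relation.Unary.Unique.Propositional using (Unique)
import Data.List.Relation.Unary.Unique.Propositional.Properties as Unique
open import Data.Bool using (true; false)
open import Data.Empty using (⊥-elim)
open import Function using (_∘_; id; case_of_)
open import Function.Definitions using (Injective)
open import Relation.Binary.PropositionalEquality
open import Relation.Nullary using (Dec; yes; no; does)
open import Relation.Nullary.Decidable using (_⊎-dec_; ¬?)
open import Relation.Unary using (Pred; Decidable)
open import Level using (0ℓ)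

private
  variable
    A : Set
    G H : Graph

Unique-⊆⇒length≤ : {xs ys : List A} → Unique xs → xs ⊆ ys → length xs ≤ length ys
Unique-⊆⇒length≤ {xs = []} _ _ = z≤n
Unique-⊆⇒length≤ {xs = x ∷ xs} {ys} (x∉xs ∷ xs!) xs⊆ys with ∈-∃++ (xs⊆ys (here refl))
... | as , bs , refl = begin
  suc (length xs)              ≤⟨ s≤s (Unique-⊆⇒length≤ xs! xs⊆as++bs) ⟩
  suc (length (as ++ bs))      ≡⟨ cong suc (length-++ as) ⟩
  suc (length as + length bs)  ≡⟨ +-suc (length as) (length bs) ⟨
  length as + length (x ∷ bs)  ≡⟨ length-++ as ⟨
  length (as ++ x ∷ bs)        ∎
  where
  open ≤-Reasoning
  xs⊆as++bs : xs ⊆ as ++ bs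
  xs⊆as++bs {y} y∈xs with ∈-++⁻ as (xs⊆ys (there y∈xs))
  ... | inj₁ y∈as         = ∈-++⁺ˡ y∈as
  ... | inj₂ (here refl)  = ⊥-elim (All.lookup x∉xs y∈xs refl)
  ... | inj₂ (there y∈bs) = ∈-++⁺ʳ as y∈bs

length-filter+filter-¬ : {P : Pred A 0ℓ} (P? : Decidable P) (xs : List A) →
  length (filter P? xs) + length (filter (¬? ∘ P?) xs) ≡ length xs
length-filter+filter-¬ P? [] = refl
length-filter+filter-¬ P? (x ∷ xs) with does (P? x)
... | true  = cong suc (length-filter+filter-¬ P? xs)
... | false = trans (+-suc _ _) (cong suc (length-filter+filter-¬ P? xs))

length-filter-∷ : {P : Pred A 0ℓ} (P? : Decidable P) (x : A) (xs : List A) →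
                  length (filter P? xs) ≤ length (filter P? (x ∷ xs))
length-filter-∷ P? x xs with does (P? x)
... | true  = n≤1+n _
... | false = ≤-refl

length-filter-tabulate≥ : ∀ n {P : Pred A 0ℓ} (P? : Decidable P) (h : Fin n → A) {X lo : ℕ} →
  (∀ k → toℕ k < X ⊎ lo ≤ toℕ k → P (h k)) → X ≤ lo → X ≤ n →
  X + (n ∸ lo) ≤ length (filter P? (tabulate h))
length-filter-tabulate≥ zero P? h {lo = lo} _ _ z≤n = ≤-reflexive (0∸n≡0 lo)
length-filter-tabulate≥ (suc n) P? h {zero} {zero} P-at _ _ = ≤-reflexive (sym (begin
  length (filter P? (tabulate h))  ≡⟨ cong length (filter-all P? (tabulate⁺ λ k → P-at k (inj₂ z≤n))) ⟩
  length (tabulate h)              ≡⟨ length-tabulate h ⟩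
  suc n                            ∎))
  where open ≡-Reasoning
length-filter-tabulate≥ (suc n) {P} P? h {zero} {suc lo} P-at _ _ =
  ≤-trans (length-filter-tabulate≥ n P? (h ∘ suc) P-at-suc z≤n z≤n) (length-filter-∷ P? (h zero) _)
  where
  P-at-suc : ∀ k → toℕ k < 0 ⊎ lo ≤ toℕ k → P (h (suc k))
  P-at-suc k (inj₂ lo≤k) = P-at (suc k) (inj₂ (s≤s lo≤k))
length-filter-tabulate≥ (suc n) P? h {suc X} {suc lo} P-at (s≤s X≤lo) (s≤s X≤n) with P? (h zero)
... | yes _  = s≤s (length-filter-tabulate≥ n P? (h ∘ suc) (λ k → P-at (suc k) ∘ Sum.map s≤s s≤s) X≤lo X≤n)
... | no ¬P₀ = ⊥-elim (¬P₀ (P-at zero (inj₁ (s≤s z≤n))))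

length-cartesianProduct : {B : Set} (xs : List A) (ys : List B) →
                          length (cartesianProduct xs ys) ≡ length xs * length ys
length-cartesianProduct []       ys = refl
length-cartesianProduct (x ∷ xs) ys = begin
  length (map (x ,_) ys ++ cartesianProduct xs ys)          ≡⟨ length-++ (map (x ,_) ys) ⟩
  length (map (x ,_) ys) + length (cartesianProduct xs ys)  ≡⟨ cong₂ _+_ (length-map (x ,_) ys)
                                                                        (length-cartesianProduct xs ys) ⟩
  length ys + length xs * length ys                         ∎
  where open ≡-Reasoning

data Activated (G : Graph) (t : ℕ) (P : V G → Set) : V G → Set where
  seed : ∀ {v} → P v → Activated G t P v
  step : ∀ {v} (ns : List (V G)) → Unique ns → t ≤ length ns →
         All (λ w → Adj G v w × Activated G t P w) ns → Activated G t P v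

module _ {t : ℕ} {P : V G → Set} {D : List (V G)} (P⊆D : ∀ {v} → P v → v ∈ D) where

  Activated⇒Active : ∀ {v} → Activated G t P v → Active G t D v
  Activated⇒Active-All : ∀ {v} ns → All (λ w → Adj G v w × Activated G t P w) ns →
                         All (λ w → Adj G v w × Active G t D w) ns

  Activated⇒Active (seed p)         = seed (P⊆D p)
  Activated⇒Active (step ns ns! l al) = step ns ns! l (Activated⇒Active-All ns al)

  Activated⇒Active-All []       []              = []
  Activated⇒Active-All (w ∷ ns) ((a , x) ∷ al) = (a , Activated⇒Active x) ∷ Activated⇒Active-All ns al

module _ {P : V G → Set} {Q : V H → Set} {t s : ℕ}
  (φ : V G → V H) (φ-injective : Injective _≡_ _≡_ φ)
  (φ-adj : ∀ {u v} → Adj G u v → Adj H (φ u) (φ v))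
  (φ-seed : ∀ {u} → P u → Activated H s Q (φ u))
  (extra : V G → List (V H))
  (s≤extra+t : ∀ u → s ≤ length (extra u) + t)
  (extra-unique : ∀ u → Unique (extra u))
  (extra-∉-image : ∀ u v → φ v ∉ extra u)
  (extra-active : ∀ u → All (λ x → Adj H (φ u) x × Activated H s Q x) (extra u))
  where

  Activated-embed : ∀ {u} → Activated G t P u → Activated H s Q (φ u)
  Activated-embed-All : ∀ {u} ns → All (λ w → Adj G u w × Activated G t P w) ns →
                        All (λ x → Adj H (φ u) x × Activated H s Q x) (map φ ns)

  Activated-embed (seed p) = φ-seed p
  Activated-embed {u} (step ns ns! t≤ns al) =
    step (extra u ++ map φ ns) unique s≤length
         (All-++⁺ (extra-active u) (Activated-embed-All ns al))
    where
    unique : Unique (extra u ++ map φ ns)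
    unique = Unique.++⁺ (extra-unique u) (Unique.map⁺ φ-injective ns!) λ where
      (x∈extra , x∈image) → case ∈-map⁻ φ x∈image of λ where
        (v , _ , refl) → extra-∉-image u v x∈extra
    s≤length : s ≤ length (extra u ++ map φ ns)
    s≤length = begin
      s                                 ≤⟨ s≤extra+t u ⟩
      length (extra u) + t              ≤⟨ +-monoʳ-≤ (length (extra u)) t≤ns ⟩
      length (extra u) + length ns      ≡⟨ cong (length (extra u) +_) (length-map φ ns) ⟨
      length (extra u) + length (map φ ns) ≡⟨ length-++ (extra u) ⟨
      length (extra u ++ map φ ns)      ∎
      where open ≤-Reasoning

  Activated-embed-All []       []              = []
  Activated-embed-All (w ∷ ns) ((a , x) ∷ al) = (φ-adj a , Activated-embed x) ∷ Activated-embed-All ns al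

Activated-map : {P : V G → Set} {Q : V H → Set} {t : ℕ} (φ : V G → V H) → Injective _≡_ _≡_ φ →
  (∀ {u v} → Adj G u v → Adj H (φ u) (φ v)) → (∀ {u} → P u → Q (φ u)) →
  ∀ {u} → Activated G t P u → Activated H t Q (φ u)
Activated-map φ φ-injective φ-adj φ-seed =
  Activated-embed φ φ-injective φ-adj (seed ∘ φ-seed) (λ _ → []) (λ _ → ≤-refl) (λ _ → []) (λ _ _ ()) (λ _ → [])

Ready : (G : Graph) → ℕ → List (V G) → V G → Set
Ready G t D w = Σ (List (V G)) λ ns → Unique ns × t ≤ length ns × All (λ x → Adj G w x × x ∈ D) ns

-- The first vertex to become active outside D is activated by vertices of D alone.
module _ {t : ℕ} {D : List (V G)} where

  Active⇒∈⊎Ready : ∀ {v} → Active G t D v → v ∈ D ⊎ ∃ (Ready G t D)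
  Active-All⇒⊆⊎Ready : ∀ {v} ns → All (λ w → Adj G v w × Active G t D w) ns →
                       All (_∈ D) ns ⊎ ∃ (Ready G t D)

  Active⇒∈⊎Ready (seed v∈D) = inj₁ v∈D
  Active⇒∈⊎Ready {v} (step ns ns! t≤ns al) with Active-All⇒⊆⊎Ready ns al
  ... | inj₁ ns⊆D = inj₂ (v , ns , ns! , t≤ns , All.zip (All.map proj₁ al , ns⊆D))
  ... | inj₂ ready = inj₂ ready

  Active-All⇒⊆⊎Ready []       []              = inj₁ []
  Active-All⇒⊆⊎Ready (w ∷ ns) ((_ , x) ∷ al) with Active⇒∈⊎Ready x | Active-All⇒⊆⊎Ready ns al
  ... | inj₂ ready | _           = inj₂ ready
  ... | inj₁ _     | inj₂ ready  = inj₂ ready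
  ... | inj₁ w∈D   | inj₁ ns⊆D   = inj₁ (w∈D ∷ ns⊆D)

Ready-⊆⇒≤length : ∀ {t D w} {E : List (V G)} → Ready G t D w → (∀ {x} → Adj G w x → x ∈ D → x ∈ E) →
                  t ≤ length E
Ready-⊆⇒≤length (ns , ns! , t≤ns , al) ⊆E =
  ≤-trans t≤ns (Unique-⊆⇒length≤ ns! λ x∈ns → let (a , x∈D) = All.lookup al x∈ns in ⊆E a x∈D)

module Restriction {D : List (V H)} {t e : ℕ}
  (φ : V G → V H) (φ-reflects : ∀ {u v} → Adj H (φ u) (φ v) → Adj G u v)
  (lost : V G → List (V H)) (lost-length : ∀ u → length (lost u) ≤ e)
  (classify : ∀ u x → Adj H (φ u) x → x ∈ lost u ⊎ ∃ λ v → φ v ≡ x)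
  where

  Pulled : V H → Set
  Pulled x = ∀ u → φ u ≡ x → Activated G t (λ v → φ v ∈ D) u

  pullback : ∀ {u ns} → All (λ x → Adj H (φ u) x × Pulled x) ns → List (V G)
  pullback [] = []
  pullback {u} {x ∷ _} ((a , _) ∷ al) with classify u x a
  ... | inj₁ _       = pullback al
  ... | inj₂ (v , _) = v ∷ pullback al

  pullback-sound : ∀ {u ns} (al : All (λ x → Adj H (φ u) x × Pulled x) ns) →
    All (λ v → φ v ∈ ns × Adj G u v × Activated G t (λ v → φ v ∈ D) v) (pullback al)
  pullback-sound [] = []
  pullback-sound {u} {x ∷ _} ((a , x↑) ∷ al) with classify u x a
  ... | inj₁ _          = All.map (λ (φv∈ , rest) → there φv∈ , rest) (pullback-sound al)
  ... | inj₂ (v , refl) = (here refl , φ-reflects a , x↑ v refl)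
                        ∷ All.map (λ (φv∈ , rest) → there φv∈ , rest) (pullback-sound al)

  pullback-unique : ∀ {u ns} → Unique ns → (al : All (λ x → Adj H (φ u) x × Pulled x) ns) →
                    Unique (pullback al)
  pullback-unique [] [] = []
  pullback-unique {u} {x ∷ _} (x∉ns ∷ xs!) ((a , _) ∷ al) with classify u x a
  ... | inj₁ _          = pullback-unique xs! al
  ... | inj₂ (v , refl) = All.map (λ (φw∈ns , _) v≡w → All.lookup x∉ns φw∈ns (cong φ v≡w)) (pullback-sound al)
                        ∷ pullback-unique xs! al

  pullback-cover : ∀ {u ns} (al : All (λ x → Adj H (φ u) x × Pulled x) ns) →
                   ns ⊆ lost u ++ map φ (pullback al)
  pullback-cover {u} {x ∷ _} ((a , _) ∷ al) y∈ with classify u x a | y∈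
  ... | inj₁ x∈lost     | here refl = ∈-++⁺ˡ x∈lost
  ... | inj₁ _          | there y∈′ = pullback-cover al y∈′
  ... | inj₂ (v , refl) | here refl = ∈-++⁺ʳ (lost u) (here refl)
  ... | inj₂ (v , refl) | there y∈′ with ∈-++⁻ (lost u) (pullback-cover al y∈′)
  ...   | inj₁ y∈lost  = ∈-++⁺ˡ y∈lost
  ...   | inj₂ y∈image = ∈-++⁺ʳ (lost u) (there y∈image)

  restrict : ∀ {x} → Active H (e + t) D x → Pulled x
  restrict-All : ∀ {x} ns → All (λ y → Adj H x y × Active H (e + t) D y) ns →
                 All (λ y → Adj H x y × Pulled y) ns

  restrict (seed x∈D) u refl = seed x∈D
  restrict (step ns ns! e+t≤ns al) u refl =
    step (pullback al↑) (pullback-unique ns! al↑) t≤length (All.map proj₂ (pullback-sound al↑))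
    where
    al↑ = restrict-All ns al
    t≤length : t ≤ length (pullback al↑)
    t≤length = +-cancelˡ-≤ e t _ (begin
      e + t                                        ≤⟨ e+t≤ns ⟩
      length ns                                    ≤⟨ Unique-⊆⇒length≤ ns! (pullback-cover al↑) ⟩
      length (lost u ++ map φ (pullback al↑))      ≡⟨ length-++ (lost u) ⟩
      length (lost u) + length (map φ (pullback al↑)) ≡⟨ cong (length (lost u) +_) (length-map φ (pullback al↑)) ⟩
      length (lost u) + length (pullback al↑)      ≤⟨ +-monoˡ-≤ _ (lost-length u) ⟩
      e + length (pullback al↑)                    ∎)
      where open ≤-Reasoning

  restrict-All []       []              = []
  restrict-All (y ∷ ns) ((a , y-active) ∷ al) = (a , restrict y-active) ∷ restrict-All ns al

Cell : ℕ → Set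
Cell n = Fin n × Fin n

Grid : ℕ → Graph
Grid n = K n □ K n

_≟ᶜ_ : ∀ {n} (u v : Cell n) → Dec (u ≡ v)
_≟ᶜ_ = ≡-dec _≟ᶠ_ _≟ᶠ_

cells : ∀ n → List (Cell n)
cells n = cartesianProduct (allFin n) (allFin n)

∈-cells : ∀ {n} (v : Cell n) → v ∈ cells n
∈-cells (a , b) = ∈-cartesianProduct⁺ (∈-allFin a) (∈-allFin b)

cells-unique : ∀ n → Unique (cells n)
cells-unique n = Unique.cartesianProduct⁺ (Unique.allFin⁺ n) (Unique.allFin⁺ n)

length-cells : ∀ n → length (cells n) ≡ n * n
length-cells n = trans (length-cartesianProduct (allFin n) (allFin n))
                       (cong₂ _*_ (length-tabulate {A = Fin n} id) (length-tabulate {A = Fin n} id))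

InCross : ∀ {n} → Cell n → Cell n → Set
InCross (a , b) (c , d) = c ≡ a ⊎ d ≡ b

inCross? : ∀ {n} (v : Cell n) → Decidable (InCross v)
inCross? (a , b) (c , d) = (c ≟ᶠ a) ⊎-dec (d ≟ᶠ b)

Adj⇒InCross : ∀ {n} {v w : Cell n} → Adj (Grid n) v w → InCross v w
Adj⇒InCross (inj₁ (a≡c , _)) = inj₁ (sym a≡c)
Adj⇒InCross (inj₂ (b≡d , _)) = inj₂ (sym b≡d)

module DeleteCross {m : ℕ} (i j : Fin (suc m)) where

  embed : Cell m → Cell (suc m)
  embed (a , b) = punchIn i a , punchIn j b

  embed-injective : Injective _≡_ _≡_ embed
  embed-injective {a , b} {c , d} eq =
    cong₂ _,_ (punchIn-injective i a c (cong proj₁ eq)) (punchIn-injective j b d (cong proj₂ eq))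

  embed-reflects : ∀ {u v} → Adj (Grid (suc m)) (embed u) (embed v) → Adj (Grid m) u v
  embed-reflects {a , b} {c , d} (inj₁ (a≡c , b≢d)) = inj₁ (punchIn-injective i a c a≡c , b≢d ∘ cong (punchIn j))
  embed-reflects {a , b} {c , d} (inj₂ (b≡d , a≢c)) = inj₂ (punchIn-injective j b d b≡d , a≢c ∘ cong (punchIn i))

  lost : Cell m → List (Cell (suc m))
  lost (a , b) = (i , punchIn j b) ∷ (punchIn i a , j) ∷ []

  classify : ∀ u x → Adj (Grid (suc m)) (embed u) x → x ∈ lost u ⊎ ∃ λ v → embed v ≡ x
  classify (a , b) (c , d) adj with c ≟ᶠ i | d ≟ᶠ j | adj
  ... | yes refl | _        | inj₁ (a↑≡i , _) = ⊥-elim (punchInᵢ≢i i a a↑≡i)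
  ... | yes refl | _        | inj₂ (refl , _) = inj₁ (here refl)
  ... | no _     | yes refl | inj₂ (b↑≡j , _) = ⊥-elim (punchInᵢ≢i j b b↑≡j)
  ... | no _     | yes refl | inj₁ (refl , _) = inj₁ (there (here refl))
  ... | no c≢i   | no d≢j   | _ =
    inj₂ ((punchOut (c≢i ∘ sym) , punchOut (d≢j ∘ sym)) , cong₂ _,_ (punchIn-punchOut _) (punchIn-punchOut _))

  remaining : List (Cell (suc m)) → List (Cell m)
  remaining D = filter (λ u → any? (embed u ≟ᶜ_) D) (cells m)

  remaining-unique : ∀ D → Unique (remaining D)
  remaining-unique D = Unique.filter⁺ (λ u → any? (embed u ≟ᶜ_) D) (cells-unique m)

  remaining-dynMono : ∀ {t D} → IsDynMono (Grid (suc m)) (2 + t) D → IsDynMono (Grid m) t (remaining D)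
  remaining-dynMono {t} {D} D-dyn u =
    Activated⇒Active (∈-filter⁺ (λ u → any? (embed u ≟ᶜ_) D) (∈-cells _)) (restrict (D-dyn (embed u)) u refl)
    where
    open Restriction {H = Grid (suc m)} {G = Grid m} {D} {t} {2}
                     embed embed-reflects lost (λ _ → ≤-refl) classify

  length-remaining : ∀ D → length (remaining D) ≤ length (filter (¬? ∘ inCross? (i , j)) D)
  length-remaining D = begin
    length (remaining D)            ≡⟨ length-map embed (remaining D) ⟨
    length (map embed (remaining D)) ≤⟨ Unique-⊆⇒length≤ (Unique.map⁺ embed-injective (remaining-unique D)) image⊆ ⟩
    length (filter (¬? ∘ inCross? (i , j)) D) ∎
    where
    open ≤-Reasoning
    image⊆ : map embed (remaining D) ⊆ filter (¬? ∘ inCross? (i , j)) D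
    image⊆ x∈ with ∈-map⁻ embed x∈
    ... | (a , b) , u∈ , refl = ∈-filter⁺ (¬? ∘ inCross? (i , j))
            (proj₂ (∈-filter⁻ (λ u → any? (embed u ≟ᶜ_) D) {xs = cells m} u∈))
            λ { (inj₁ a↑≡i) → punchInᵢ≢i i a a↑≡i ; (inj₂ b↑≡j) → punchInᵢ≢i j b b↑≡j }

minSeeds : ℕ → ℕ
minSeeds zero          = 0
minSeeds (suc zero)    = 1
minSeeds (suc (suc t)) = suc (suc t) + minSeeds t

minSeeds≤square : ∀ t n → t < 2 * n → minSeeds t ≤ n * n
minSeeds≤square zero          n       _    = z≤n
minSeeds≤square (suc zero)    (suc n) _    = s≤s z≤n
minSeeds≤square (suc (suc t)) (suc m) t<2n = begin
  suc (suc t) + minSeeds t  ≤⟨ +-mono-≤ t+2≤2m+1 (minSeeds≤square t m (≤-pred t+2≤2m+1)) ⟩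
  suc (2 * m) + m * m       ≡⟨ solve 1 (λ m → (con 1 :+ con 2 :* m) :+ m :* m := (con 1 :+ m) :* (con 1 :+ m)) refl m ⟩
  suc m * suc m             ∎
  where
  open ≤-Reasoning
  t+2≤2m+1 : suc (suc t) ≤ suc (2 * m)
  t+2≤2m+1 = ≤-pred (≤-trans t<2n (≤-reflexive (*-suc 2 m)))

minSeeds≤length : ∀ t n (D : List (Cell n)) → Unique D → IsDynMono (Grid n) t D → t < 2 * n →
                  minSeeds t ≤ length D
minSeeds≤length zero       n       D _ _     _ = z≤n
minSeeds≤length (suc zero) (suc m) D _ D-dyn _ with Active⇒∈⊎Ready (D-dyn (zero , zero))
... | inj₁ v∈D          = ≤-trans (s≤s z≤n) (Unique-⊆⇒length≤ ([] ∷ []) λ { (here refl) → v∈D })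
... | inj₂ (_ , ready)  = Ready-⊆⇒≤length {G = Grid (suc m)} ready λ _ x∈D → x∈D
minSeeds≤length (suc (suc t)) (suc m) D D! D-dyn t<2n with all? (λ v → any? (v ≟ᶜ_) D) (cells (suc m))
... | yes cells⊆D = begin
  minSeeds (suc (suc t))    ≤⟨ minSeeds≤square (suc (suc t)) (suc m) t<2n ⟩
  suc m * suc m             ≡⟨ length-cells (suc m) ⟨
  length (cells (suc m))    ≤⟨ Unique-⊆⇒length≤ (cells-unique (suc m)) (All.lookup cells⊆D) ⟩
  length D                  ∎
  where open ≤-Reasoning
... | no ¬cells⊆D with satisfied (¬All⇒Any¬ (λ v → any? (v ≟ᶜ_) D) (cells (suc m)) ¬cells⊆D)
...   | v , v∉D with Active⇒∈⊎Ready (D-dyn v)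
...     | inj₁ v∈D = ⊥-elim (v∉D v∈D)
...     | inj₂ ((i , j) , ready) = begin
  suc (suc t) + minSeeds t
    ≤⟨ +-mono-≤ inCross outsideCross ⟩
  length (filter (inCross? (i , j)) D) + length (filter (¬? ∘ inCross? (i , j)) D)
    ≡⟨ length-filter+filter-¬ (inCross? (i , j)) D ⟩
  length D ∎
  where
  open ≤-Reasoning
  open DeleteCross i j
  inCross : suc (suc t) ≤ length (filter (inCross? (i , j)) D)
  inCross = Ready-⊆⇒≤length {G = Grid (suc m)} ready λ adj x∈D → ∈-filter⁺ (inCross? (i , j)) x∈D (Adj⇒InCross adj)
  outsideCross : minSeeds t ≤ length (filter (¬? ∘ inCross? (i , j)) D)
  outsideCross = ≤-trans (minSeeds≤length t m (remaining D) (remaining-unique D) (remaining-dynMono D-dyn)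
                            (≤-pred (≤-pred (≤-trans t<2n (≤-reflexive (*-suc 2 m))))))
                         (length-remaining D)

cellSum : ∀ {n} → Cell n → ℕ
cellSum (a , b) = toℕ a + toℕ b

Seed : ∀ n → ℕ → ℕ → Cell n → Set
Seed n X Y u = cellSum u < X ⊎ 2 * (n ∸ 1) < cellSum u + Y

toℕ+Y≤2m : ∀ {m Y} → Y ≤ m → (j : Fin (suc m)) → toℕ j + Y ≤ 2 * m
toℕ+Y≤2m {m} Y≤m j = ≤-trans (+-mono-≤ (≤-pred (toℕ<n j)) Y≤m) (≤-reflexive (cong (m +_) (sym (+-identityʳ m))))

module FirstRow (m X Y : ℕ) (Y≤m : Y ≤ m) where

  Reached : Cell (suc m) → Set
  Reached = Activated (Grid (suc m)) (X + Y) (Seed (suc m) X Y)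

  module _ (j : Fin (suc m)) where

    RowNbr ColNbr : Fin (suc m) → Set
    RowNbr c = toℕ c < X ⊎ toℕ j < toℕ c
    ColNbr r = 2 * m < toℕ r + toℕ j + Y

    rowNbr? : Decidable RowNbr
    rowNbr? c = (toℕ c <? X) ⊎-dec (toℕ j <? toℕ c)

    colNbr? : Decidable ColNbr
    colNbr? r = 2 * m <? toℕ r + toℕ j + Y

    rowNbrs colNbrs : List (Fin (suc m))
    rowNbrs = filter rowNbr? (allFin _)
    colNbrs = filter colNbr? (allFin _)

    nbrs : List (Cell (suc m))
    nbrs = map (zero ,_) rowNbrs ++ map (_, j) colNbrs

    nbrs-unique : Unique nbrs
    nbrs-unique = Unique.++⁺ (Unique.map⁺ (cong proj₂) (Unique.filter⁺ rowNbr? (Unique.allFin⁺ _)))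
                             (Unique.map⁺ (cong proj₁) (Unique.filter⁺ colNbr? (Unique.allFin⁺ _)))
      λ (x∈row , x∈col) → case ∈-map⁻ (zero ,_) x∈row , ∈-map⁻ (_, j) x∈col of λ where
        ((_ , _ , refl) , (_ , r∈ , refl)) →
          <⇒≱ (proj₂ (∈-filter⁻ colNbr? {xs = allFin _} r∈)) (toℕ+Y≤2m Y≤m j)

    nbrs-active : toℕ j ≮ X → (∀ j′ → toℕ j < toℕ j′ → Reached (zero , j′)) →
                  All (λ x → Adj (Grid (suc m)) (zero , j) x × Reached x) nbrs
    nbrs-active j≮X later = All-++⁺ (map⁺ (All.map rowNbr-active (all-filter rowNbr? (allFin _))))
                                    (map⁺ (All.map colNbr-active (all-filter colNbr? (allFin _))))
      where
      rowNbr-active : ∀ {c} → RowNbr c → Adj (Grid (suc m)) (zero , j) (zero , c) × Reached (zero , c)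
      rowNbr-active (inj₁ c<X) = inj₁ (refl , λ { refl → j≮X c<X }) , seed (inj₁ c<X)
      rowNbr-active (inj₂ j<c) = inj₁ (refl , λ { refl → <-irrefl refl j<c }) , later _ j<c
      colNbr-active : ∀ {r} → ColNbr r → Adj (Grid (suc m)) (zero , j) (r , j) × Reached (r , j)
      colNbr-active 2m<r+j+Y = inj₂ (refl , λ { refl → <⇒≱ 2m<r+j+Y (toℕ+Y≤2m Y≤m j) }) , seed (inj₂ 2m<r+j+Y)

    length-rowNbrs : X ≤ toℕ j → X + (m ∸ toℕ j) ≤ length rowNbrs
    length-rowNbrs X≤j =
      length-filter-tabulate≥ (suc m) rowNbr? id (λ _ → id) (m≤n⇒m≤1+n X≤j) (≤-trans X≤j (<⇒≤ (toℕ<n j)))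

    -- Column j meets the far corner triangle in the rows from colStart on.
    colStart : ℕ
    colStart = (suc m ∸ Y) + (m ∸ toℕ j)

    colStart≤⇒ColNbr : ∀ r → colStart ≤ toℕ r → ColNbr r
    colStart≤⇒ColNbr r colStart≤r = begin-strict
      2 * m                                    <⟨ s≤s (≤-reflexive (cong (m +_) (+-identityʳ m))) ⟩
      suc m + m                                ≡⟨ cong₂ _+_ (m∸n+n≡m (m≤n⇒m≤1+n Y≤m)) (m∸n+n≡m (≤-pred (toℕ<n j))) ⟨
      (suc m ∸ Y) + Y + ((m ∸ toℕ j) + toℕ j)  ≡⟨ solve 4 (λ a Y b j → a :+ Y :+ (b :+ j) := a :+ b :+ j :+ Y) refl
                                                    (suc m ∸ Y) Y (m ∸ toℕ j) (toℕ j) ⟩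
      colStart + toℕ j + Y                     ≤⟨ +-monoˡ-≤ Y (+-monoˡ-≤ (toℕ j) colStart≤r) ⟩
      toℕ r + toℕ j + Y                        ∎
      where open ≤-Reasoning

    length-colNbrs : Y ∸ (m ∸ toℕ j) ≤ length colNbrs
    length-colNbrs = begin
      Y ∸ (m ∸ toℕ j)                    ≡⟨ cong (_∸ (m ∸ toℕ j)) (m∸[m∸n]≡n (m≤n⇒m≤1+n Y≤m)) ⟨
      suc m ∸ (suc m ∸ Y) ∸ (m ∸ toℕ j)  ≡⟨ ∸-+-assoc (suc m) (suc m ∸ Y) (m ∸ toℕ j) ⟩
      suc m ∸ colStart                   ≤⟨ length-filter-tabulate≥ (suc m) colNbr? id
                                              (λ { r (inj₁ ()) ; r (inj₂ colStart≤r) → colStart≤⇒ColNbr r colStart≤r })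
                                              z≤n z≤n ⟩
      length colNbrs                     ∎
      where open ≤-Reasoning

    length-nbrs : X ≤ toℕ j → X + Y ≤ length nbrs
    length-nbrs X≤j = begin
      X + Y                                        ≤⟨ +-monoʳ-≤ X (m≤n+m∸n Y (m ∸ toℕ j)) ⟩
      X + ((m ∸ toℕ j) + (Y ∸ (m ∸ toℕ j)))        ≡⟨ +-assoc X _ _ ⟨
      X + (m ∸ toℕ j) + (Y ∸ (m ∸ toℕ j))          ≤⟨ +-mono-≤ (length-rowNbrs X≤j) length-colNbrs ⟩
      length rowNbrs + length colNbrs              ≡⟨ cong₂ _+_ (length-map (zero ,_) rowNbrs) (length-map (_, j) colNbrs) ⟨
      length (map (zero ,_) rowNbrs) + length (map (_, j) colNbrs) ≡⟨ length-++ (map (zero ,_) rowNbrs) ⟨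
      length nbrs                                  ∎
      where open ≤-Reasoning

  rowCell : ∀ j → (∀ j′ → toℕ j < toℕ j′ → Reached (zero , j′)) → Reached (zero , j)
  rowCell j later with toℕ j <? X
  ... | yes j<X = seed (inj₁ j<X)
  ... | no  j≮X = step (nbrs j) (nbrs-unique j) (length-nbrs j (≮⇒≥ j≮X)) (nbrs-active j j≮X later)

  firstRow : ∀ j → Reached (zero , j)
  firstRow j = go j (>-wellFounded j)
    where
    go : ∀ j → Acc _>ᶠ_ j → Reached (zero , j)
    go j (acc later) = rowCell j λ j′ j<j′ → go j′ (later j<j′)

transpose : ∀ {n} → Cell n → Cell n
transpose (a , b) = b , a

transpose-injective : ∀ {n} → Injective _≡_ _≡_ (transpose {n})
transpose-injective {x = _ , _} {_ , _} refl = refl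

transpose-adj : ∀ {n} {u v : Cell n} → Adj (Grid n) u v → Adj (Grid n) (transpose u) (transpose v)
transpose-adj (inj₁ same-row) = inj₂ same-row
transpose-adj (inj₂ same-col) = inj₁ same-col

Seed-transpose : ∀ {n X Y} (u : Cell n) → Seed n X Y u → Seed n X Y (transpose u)
Seed-transpose {n} {X} {Y} (a , b) = subst (λ s → s < X ⊎ 2 * (n ∸ 1) < s + Y) (+-comm (toℕ a) (toℕ b))

firstColumn : ∀ m X Y → Y ≤ m → ∀ i → Activated (Grid (suc m)) (X + Y) (Seed (suc m) X Y) (i , zero)
firstColumn m X Y Y≤m i =
  Activated-map transpose transpose-injective transpose-adj (λ {u} → Seed-transpose u) (FirstRow.firstRow m X Y Y≤m i)

opposite-injective : ∀ {n} → Injective _≡_ _≡_ (opposite {n})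
opposite-injective {x = a} {b} eq =
  trans (sym (opposite-involutive a)) (trans (cong opposite eq) (opposite-involutive b))

-- The inner (n-1)×(n-1) grid, rotated by a half turn: under this identification the seeds of
-- the big grid become the seed pattern with the two corners exchanged and the first one shrunk by 2.
inner : ∀ {m} → Cell m → Cell (suc m)
inner (a , b) = suc (opposite a) , suc (opposite b)

inner-injective : ∀ {m} → Injective _≡_ _≡_ (inner {m})
inner-injective {x = a , b} {c , d} eq =
  cong₂ _,_ (opposite-injective (suc-injectiveᶠ (cong proj₁ eq))) (opposite-injective (suc-injectiveᶠ (cong proj₂ eq)))

inner-adj : ∀ {m} {u v : Cell m} → Adj (Grid m) u v → Adj (Grid (suc m)) (inner u) (inner v)
inner-adj (inj₁ (a≡c , b≢d)) = inj₁ (cong (suc ∘ opposite) a≡c , b≢d ∘ opposite-injective ∘ suc-injectiveᶠ)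
inner-adj (inj₂ (b≡d , a≢c)) = inj₂ (cong (suc ∘ opposite) b≡d , a≢c ∘ opposite-injective ∘ suc-injectiveᶠ)

cellSum-opposite : ∀ {m} (a b : Fin (suc m)) → (toℕ a + toℕ b) + (toℕ (opposite a) + toℕ (opposite b)) ≡ 2 * m
cellSum-opposite {m} a b = begin
  (toℕ a + toℕ b) + (toℕ (opposite a) + toℕ (opposite b))
    ≡⟨ solve 4 (λ a b a′ b′ → (a :+ b) :+ (a′ :+ b′) := (a′ :+ a) :+ (b′ :+ b)) refl
               (toℕ a) (toℕ b) (toℕ (opposite a)) (toℕ (opposite b)) ⟩
  (toℕ (opposite a) + toℕ a) + (toℕ (opposite b) + toℕ b)   ≡⟨ cong₂ _+_ (opposite+toℕ a) (opposite+toℕ b) ⟩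
  m + m                                                      ≡⟨ cong (m +_) (+-identityʳ m) ⟨
  2 * m                                                      ∎
  where
  open ≡-Reasoning
  opposite+toℕ : (a : Fin (suc m)) → toℕ (opposite a) + toℕ a ≡ m
  opposite+toℕ a = trans (cong (_+ toℕ a) (opposite-prop a)) (m∸n+n≡m (≤-pred (toℕ<n a)))

complement-< : ∀ {s s′ N Y} → s + s′ ≡ N → s < Y → N < s′ + Y
complement-< {s′ = s′} {Y = Y} refl s<Y = ≤-trans (+-monoˡ-< s′ s<Y) (≤-reflexive (+-comm Y s′))

complement-<⁻ : ∀ {s s′ N Y} → s + s′ ≡ N → N < s′ + Y → s < Y
complement-<⁻ {s} {s′} {Y = Y} refl N<s′+Y = +-cancelʳ-< s′ s Y (≤-trans N<s′+Y (≤-reflexive (+-comm s′ Y)))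

<∸2⇒2+< : ∀ s X → s < X ∸ 2 → 2 + s < X
<∸2⇒2+< s (suc (suc X)) s<X = s≤s (s≤s s<X)

2+<⇒<∸2 : ∀ s X → 2 + s < X → s < X ∸ 2
2+<⇒<∸2 s (suc (suc X)) (s≤s (s≤s s<X)) = s<X

module _ {m X Y : ℕ} (a b : Fin (suc m)) where

  private
    s s′ : ℕ
    s  = toℕ a + toℕ b
    s′ = toℕ (opposite a) + toℕ (opposite b)

    sum-inner : cellSum (inner (a , b)) ≡ 2 + s′
    sum-inner = cong suc (+-suc (toℕ (opposite a)) (toℕ (opposite b)))

    sum-shift : toℕ (suc a) + toℕ (suc b) ≡ 2 + s
    sum-shift = cong suc (+-suc (toℕ a) (toℕ b))

    2m+2 : 2 * (suc (suc m) ∸ 1) ≡ 2 + 2 * m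
    2m+2 = *-suc 2 m

  Seed-inner : Seed (suc m) Y (X ∸ 2) (a , b) → Seed (suc (suc m)) X Y (inner (a , b))
  Seed-inner (inj₁ s<Y) = inj₂ (subst₂ _<_ (sym 2m+2) (cong (_+ Y) (sym sum-inner))
                                (s≤s (s≤s (complement-< (cellSum-opposite a b) s<Y))))
  Seed-inner (inj₂ 2m<s+X-2) = inj₁ (subst (_< X) (sym sum-inner)
    (<∸2⇒2+< s′ X (complement-<⁻ (trans (+-comm s′ s) (cellSum-opposite a b)) 2m<s+X-2)))

  Seed-outer : Seed (suc (suc m)) X Y (suc a , suc b) → Seed (suc m) Y (X ∸ 2) (opposite a , opposite b)
  Seed-outer (inj₁ s+2<X) =
    inj₂ (complement-< (cellSum-opposite a b) (2+<⇒<∸2 s X (subst (_< X) sum-shift s+2<X)))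
  Seed-outer (inj₂ 2m+2<s+2+Y) =
    inj₁ (complement-<⁻ (trans (+-comm s′ s) (cellSum-opposite a b))
           (≤-pred (≤-pred (subst₂ _<_ 2m+2 (cong (_+ Y) sum-shift) 2m+2<s+2+Y))))

X+Y≤2+Y+[X∸2] : ∀ X Y → X + Y ≤ 2 + (Y + (X ∸ 2))
X+Y≤2+Y+[X∸2] zero          Y = ≤-trans (m≤n+m Y 2) (≤-reflexive (cong (2 +_) (sym (+-identityʳ Y))))
X+Y≤2+Y+[X∸2] (suc zero)    Y = s≤s (≤-trans (n≤1+n Y) (≤-reflexive (cong suc (sym (+-identityʳ Y)))))
X+Y≤2+Y+[X∸2] (suc (suc X)) Y = s≤s (s≤s (≤-reflexive (+-comm X Y)))

seeds-activate : ∀ n X Y → X ≤ n → Y ≤ n ∸ 1 → ∀ v → Activated (Grid n) (X + Y) (Seed n X Y) v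
seeds-activate (suc m) X Y _ Y≤m (zero , j)      = FirstRow.firstRow m X Y Y≤m j
seeds-activate (suc m) X Y _ Y≤m (suc a , zero)  = firstColumn m X Y Y≤m (suc a)
seeds-activate (suc (suc m)) X Y X≤n Y≤m (suc a , suc b) =
  subst (Activated (Grid (suc (suc m))) (X + Y) (Seed (suc (suc m)) X Y))
        (cong₂ (λ a b → suc a , suc b) (opposite-involutive a) (opposite-involutive b))
        (Activated-embed inner inner-injective inner-adj (λ {u} → seed ∘ Seed-inner (proj₁ u) (proj₂ u))
           border (λ _ → X+Y≤2+Y+[X∸2] X Y) (λ _ → ((λ ()) ∷ []) ∷ [] ∷ [])
           (λ { _ (_ , _) (here ()) ; _ (_ , _) (there (here ())) }) border-active
           (seeds-activate (suc m) Y (X ∸ 2) Y≤m (∸-monoˡ-≤ 2 X≤n) (opposite a , opposite b)))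
  where
  border : Cell (suc m) → List (Cell (suc (suc m)))
  border u = (zero , proj₂ (inner u)) ∷ (proj₁ (inner u) , zero) ∷ []
  border-active : ∀ u → All (λ x → Adj (Grid (suc (suc m))) (inner u) x ×
                                   Activated (Grid (suc (suc m))) (X + Y) (Seed (suc (suc m)) X Y) x) (border u)
  border-active (c , d) = (inj₂ (refl , λ ()) , FirstRow.firstRow (suc m) X Y Y≤m (suc (opposite d)))
                        ∷ (inj₁ (refl , λ ()) , firstColumn (suc m) X Y Y≤m (suc (opposite c))) ∷ []

below? : ∀ {k} (X : ℕ) (c : Fin k) → Dec (toℕ c < X)
below? X c = toℕ c <? X

length-filter-below : ∀ {k} X → length (filter (below? X) (allFin k)) ≤ X
length-filter-below {k} X = begin
  length (filter (below? X) (allFin k))             ≡⟨ length-map toℕ (filter (below? X) (allFin k)) ⟨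
  length (map toℕ (filter (below? X) (allFin k)))   ≤⟨ Unique-⊆⇒length≤ toℕs-unique (∈-upTo⁺ ∘ All.lookup toℕs<X) ⟩
  length (upTo X)                                   ≡⟨ length-upTo X ⟩
  X                                                 ∎
  where
  open ≤-Reasoning
  toℕs-unique : Unique (map toℕ (filter (below? X) (allFin k)))
  toℕs-unique = Unique.map⁺ toℕ-injective (Unique.filter⁺ (below? X) (Unique.allFin⁺ k))
  toℕs<X : All (_< X) (map toℕ (filter (below? X) (allFin k)))
  toℕs<X = map⁺ (all-filter (below? X) (allFin k))

rowSeeds : ∀ m → ℕ → List (Cell (suc m))
rowSeeds m X = map (zero ,_) (filter (below? X) (allFin (suc m)))

columnSeeds : ∀ m → ℕ → List (Cell (suc m))
columnSeeds m X = map (λ r → suc r , zero) (filter (below? (X ∸ 1)) (allFin m))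

seedList : ∀ n → ℕ → ℕ → List (Cell n)
seedList zero    X Y = []
seedList (suc m) X Y = rowSeeds m X ++ columnSeeds m X ++ map inner (seedList m Y (X ∸ 2))

seedList-unique : ∀ n X Y → Unique (seedList n X Y)
seedList-unique zero    X Y = []
seedList-unique (suc m) X Y =
  Unique.++⁺ (Unique.map⁺ (cong proj₂) (Unique.filter⁺ (below? X) (Unique.allFin⁺ (suc m))))
    (Unique.++⁺ (Unique.map⁺ (suc-injectiveᶠ ∘ cong proj₁) (Unique.filter⁺ (below? (X ∸ 1)) (Unique.allFin⁺ m)))
                (Unique.map⁺ inner-injective (seedList-unique m Y (X ∸ 2)))
                λ (x∈col , x∈inner) → case ∈-map⁻ _ x∈col , ∈-map⁻ inner x∈inner of λ where
                  ((_ , _ , refl) , ((_ , _) , _ , ())))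
    λ (x∈row , x∈rest) → case ∈-map⁻ _ x∈row , ∈-++⁻ (columnSeeds m X) x∈rest of λ where
      ((_ , _ , refl) , inj₁ x∈col)   → case ∈-map⁻ _ x∈col of λ where (_ , _ , ())
      ((_ , _ , refl) , inj₂ x∈inner) → case ∈-map⁻ inner x∈inner of λ where ((_ , _) , _ , ())

triangle : ℕ → ℕ
triangle zero    = 0
triangle (suc x) = suc x + triangle x

triangle-peel : ∀ X → X + (X ∸ 1) + triangle (X ∸ 2) ≡ triangle X
triangle-peel zero          = refl
triangle-peel (suc zero)    = refl
triangle-peel (suc (suc X)) = +-assoc (suc (suc X)) (suc X) (triangle X)

length-seedList : ∀ n X Y → length (seedList n X Y) ≤ triangle X + triangle Y
length-seedList zero    X Y = z≤n
length-seedList (suc m) X Y = begin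
  length (rowSeeds m X ++ columnSeeds m X ++ innerSeeds)
    ≡⟨ length-++ (rowSeeds m X) ⟩
  length (rowSeeds m X) + length (columnSeeds m X ++ innerSeeds)
    ≡⟨ cong (length (rowSeeds m X) +_) (length-++ (columnSeeds m X)) ⟩
  length (rowSeeds m X) + (length (columnSeeds m X) + length innerSeeds)
    ≤⟨ +-mono-≤ length-rowSeeds (+-mono-≤ length-columnSeeds length-innerSeeds) ⟩
  X + ((X ∸ 1) + (triangle Y + triangle (X ∸ 2)))
    ≡⟨ solve 4 (λ x x₁ y x₂ → x :+ (x₁ :+ (y :+ x₂)) := (x :+ x₁ :+ x₂) :+ y) refl
               X (X ∸ 1) (triangle Y) (triangle (X ∸ 2)) ⟩
  X + (X ∸ 1) + triangle (X ∸ 2) + triangle Y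
    ≡⟨ cong (_+ triangle Y) (triangle-peel X) ⟩
  triangle X + triangle Y ∎
  where
  open ≤-Reasoning
  innerSeeds = map inner (seedList m Y (X ∸ 2))
  length-rowSeeds : length (rowSeeds m X) ≤ X
  length-rowSeeds = ≤-trans (≤-reflexive (length-map (zero ,_) (filter (below? X) (allFin (suc m)))))
                            (length-filter-below {suc m} X)
  length-columnSeeds : length (columnSeeds m X) ≤ X ∸ 1
  length-columnSeeds = ≤-trans (≤-reflexive (length-map (λ r → suc r , zero) (filter (below? (X ∸ 1)) (allFin m))))
                               (length-filter-below {m} (X ∸ 1))
  length-innerSeeds : length innerSeeds ≤ triangle Y + triangle (X ∸ 2)
  length-innerSeeds = ≤-trans (≤-reflexive (length-map inner (seedList m Y (X ∸ 2)))) (length-seedList m Y (X ∸ 2))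

Seed⇒∈seedList : ∀ n X Y → X ≤ n → Y ≤ n ∸ 1 → ∀ v → Seed n X Y v → v ∈ seedList n X Y
Seed⇒∈seedList (suc m) X Y _ Y≤m (zero , j) (inj₁ j<X) =
  ∈-++⁺ˡ (∈-map⁺ (zero ,_) (∈-filter⁺ (below? X) (∈-allFin j) j<X))
Seed⇒∈seedList (suc m) X Y _ Y≤m (zero , j) (inj₂ 2m<j+Y) = ⊥-elim (<⇒≱ 2m<j+Y (toℕ+Y≤2m Y≤m j))
Seed⇒∈seedList (suc m) X Y _ Y≤m (suc r , zero) (inj₁ r+1<X) =
  ∈-++⁺ʳ (rowSeeds m X) (∈-++⁺ˡ (∈-map⁺ (λ r → suc r , zero)
    (∈-filter⁺ (below? (X ∸ 1)) (∈-allFin r) (∸-monoˡ-< (subst (_< X) (+-identityʳ _) r+1<X) (s≤s z≤n)))))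
Seed⇒∈seedList (suc m) X Y _ Y≤m (suc r , zero) (inj₂ 2m<r+1+Y) =
  ⊥-elim (<⇒≱ (subst (λ s → 2 * m < s + Y) (+-identityʳ _) 2m<r+1+Y) (toℕ+Y≤2m Y≤m (suc r)))
Seed⇒∈seedList (suc (suc m)) X Y X≤n Y≤m (suc a , suc b) s =
  ∈-++⁺ʳ (rowSeeds (suc m) X) (∈-++⁺ʳ (columnSeeds (suc m) X)
    (subst (_∈ map inner (seedList (suc m) Y (X ∸ 2)))
      (cong₂ (λ a b → suc a , suc b) (opposite-involutive a) (opposite-involutive b))
      (∈-map⁺ inner (Seed⇒∈seedList (suc m) Y (X ∸ 2) Y≤m (∸-monoˡ-≤ 2 X≤n) (opposite a , opposite b)
                      (Seed-outer a b s)))))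

dynIs-grid : ∀ n X Y → X ≤ n → Y ≤ n ∸ 1 → X + Y < 2 * n → minSeeds (X + Y) ≡ triangle X + triangle Y →
             DynIs (Grid n) (X + Y) (triangle X + triangle Y)
dynIs-grid n X Y X≤n Y≤n-1 X+Y<2n minSeeds≡ =
  (seedList n X Y , seedList-unique n X Y , seedList-dynMono ,
   ≤-antisym (length-seedList n X Y) (atLeast (seedList n X Y) (seedList-unique n X Y) seedList-dynMono)) ,
  atLeast
  where
  seedList-dynMono : IsDynMono (Grid n) (X + Y) (seedList n X Y)
  seedList-dynMono v = Activated⇒Active (Seed⇒∈seedList n X Y X≤n Y≤n-1 _) (seeds-activate n X Y X≤n Y≤n-1 v)
  atLeast : ∀ D → Unique D → IsDynMono (Grid n) (X + Y) D → triangle X + triangle Y ≤ length D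
  atLeast D D! D-dyn = subst (_≤ length D) minSeeds≡ (minSeeds≤length (X + Y) n D D! D-dyn X+Y<2n)

minSeeds-triangles : ∀ d Y → d ≤ 1 → minSeeds (d + Y + Y) ≡ triangle (d + Y) + triangle Y
minSeeds-triangles zero          zero    _         = refl
minSeeds-triangles (suc zero)    zero    _         = refl
minSeeds-triangles (suc (suc d)) zero    (s≤s ())
minSeeds-triangles d             (suc Y) d≤1       = begin
  minSeeds (d + suc Y + suc Y)
    ≡⟨ cong minSeeds (solve 2 (λ d Y → d :+ (con 1 :+ Y) :+ (con 1 :+ Y) := con 2 :+ (d :+ Y :+ Y)) refl d Y) ⟩
  suc (suc (d + Y + Y)) + minSeeds (d + Y + Y)
    ≡⟨ cong (suc (suc (d + Y + Y)) +_) (minSeeds-triangles d Y d≤1) ⟩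
  suc (suc (d + Y + Y)) + (triangle (d + Y) + triangle Y)
    ≡⟨ solve 4 (λ d Y A B → con 2 :+ (d :+ Y :+ Y) :+ (A :+ B) := (con 1 :+ (d :+ Y) :+ A) :+ (con 1 :+ Y :+ B))
               refl d Y (triangle (d + Y)) (triangle Y) ⟩
  triangle (suc (d + Y)) + triangle (suc Y)
    ≡⟨ cong (λ z → triangle z + triangle (suc Y)) (+-suc d Y) ⟨
  triangle (d + suc Y) + triangle (suc Y) ∎
  where open ≡-Reasoning

triangle-double : ∀ k → triangle k + triangle k ≡ k * (k + 1)
triangle-double zero    = refl
triangle-double (suc k) = begin
  (suc k + triangle k) + (suc k + triangle k)
    ≡⟨ solve 2 (λ k T → (con 1 :+ k :+ T) :+ (con 1 :+ k :+ T) := con 2 :+ con 2 :* k :+ (T :+ T)) refl k (triangle k) ⟩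
  2 + 2 * k + (triangle k + triangle k)
    ≡⟨ cong (2 + 2 * k +_) (triangle-double k) ⟩
  2 + 2 * k + k * (k + 1)
    ≡⟨ solve 1 (λ k → con 2 :+ con 2 :* k :+ k :* (k :+ con 1) := (con 1 :+ k) :* (con 1 :+ k :+ con 1)) refl k ⟩
  suc k * (suc k + 1) ∎
  where open ≡-Reasoning

triangle-suc+triangle : ∀ k → triangle (suc k) + triangle k ≡ suc k * suc k
triangle-suc+triangle k = begin
  suc k + triangle k + triangle k
    ≡⟨ +-assoc (suc k) (triangle k) (triangle k) ⟩
  suc k + (triangle k + triangle k)
    ≡⟨ cong (suc k +_) (triangle-double k) ⟩
  suc k + k * (k + 1)
    ≡⟨ solve 1 (λ k → con 1 :+ k :+ k :* (k :+ con 1) := (con 1 :+ k) :* (con 1 :+ k)) refl k ⟩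
  suc k * suc k ∎
  where open ≡-Reasoning

theorem14 : (t n : ℕ) → 1 ≤ t → 1 ≤ n → t ≤ 2 * n ∸ 2 →
    (∀ k → t ≡ 2 * k + 1 → DynIs (K n □ K n) t (suc k * suc k))
    × (∀ k → t ≡ 2 * k → DynIs (K n □ K n) t (k * (k + 1)))
theorem14 t (suc m) _ _ t≤2n-2 = odd , even
  where
  t≤2m : t ≤ 2 * m
  t≤2m = subst (t ≤_) (cong (_∸ 2) (*-suc 2 m)) t≤2n-2
  t<2n : t < 2 * suc m
  t<2n = ≤-trans (s≤s (m≤n⇒m≤1+n t≤2m)) (≤-reflexive (sym (*-suc 2 m)))

  odd : ∀ k → t ≡ 2 * k + 1 → DynIs (Grid (suc m)) t (suc k * suc k)
  odd k refl = subst₂ (DynIs (Grid (suc m))) k+1+k≡t (triangle-suc+triangle k)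
    (dynIs-grid (suc m) (suc k) k (m≤n⇒m≤1+n k<m) (<⇒≤ k<m) (subst (_< 2 * suc m) (sym k+1+k≡t) t<2n)
                (minSeeds-triangles 1 k (s≤s z≤n)))
    where
    k+1+k≡t : suc k + k ≡ 2 * k + 1
    k+1+k≡t = solve 1 (λ k → con 1 :+ k :+ k := con 2 :* k :+ con 1) refl k
    k<m : k < m
    k<m = *-cancelˡ-< 2 k m (subst (_≤ 2 * m) (+-comm (2 * k) 1) t≤2m)

  even : ∀ k → t ≡ 2 * k → DynIs (Grid (suc m)) t (k * (k + 1))
  even k refl = subst₂ (DynIs (Grid (suc m))) k+k≡t (triangle-double k)
    (dynIs-grid (suc m) k k (m≤n⇒m≤1+n k≤m) k≤m (subst (_< 2 * suc m) (sym k+k≡t) t<2n)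
                (minSeeds-triangles 0 k z≤n))
    where
    k+k≡t : k + k ≡ 2 * k
    k+k≡t = cong (k +_) (sym (+-identityʳ k))
    k≤m : k ≤ m
    k≤m = *-cancelˡ-≤ 2 t≤2m
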